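{- Let $G$ be a simple graph and $M$ a matching of $G$. Then $\rho_G(M)\le \chi(G_M)$.
   Context: A matching $M$ is strong (induced) if no two edges of $M$ are both adjacent to a common edge of $G$. $\rho_G(M)$ is the least $q$ such that $M$ can be partitioned into $q$ pairwise disjoint strong matchings of $G$. $G_M$ is the loopless (possibly multi-)graph obtained from $G$ by contracting every edge of $M$ (deleting it and identifying its end-vertices), and $\chi(G_M)$ is its chromatic number. -}

module Defs where

open import Data.Nat using (ℕ)
open import Data.Fin using (Fin)
open import Data.Bool using (Bool; T)
open import Data.Product using (_×_; Σ; ∃; ∃-syntax; _,_)
open import Data.Sum using (_⊎_)
open import Relation.Nullary using (¬_)
open import Relation.Binary.PropositionalEquality using (_≡_; _≢_)

record SimpleGraph (n : ℕ) : Set where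
  field
    adj   : Fin n → Fin n → Bool
    sym   : ∀ u v → T (adj u v) → T (adj v u)
    irrefl : ∀ v → ¬ T (adj v v)
open SimpleGraph public

-- Edges are represented by ordered pairs of endpoints; two pairs denote the
-- same (unordered) edge when they agree up to swapping.
Edge : ℕ → Set
Edge n = Fin n × Fin n

SameEdge : ∀ {n} → Edge n → Edge n → Set
SameEdge (a , b) (c , d) = (a ≡ c × b ≡ d) ⊎ (a ≡ d × b ≡ c)

IsEdge : ∀ {n} → SimpleGraph n → Edge n → Set
IsEdge G (u , v) = T (adj G u v)

Incident : ∀ {n} → Fin n → Edge n → Set
Incident v (a , b) = v ≡ a ⊎ v ≡ b

AdjacentEdges : ∀ {n} → Edge n → Edge n → Set
AdjacentEdges e f = ¬ SameEdge e f × ∃[ v ] (Incident v e × Incident v f)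

record EdgeSubset {n : ℕ} (G : SimpleGraph n) : Set where
  field
    mem    : Fin n → Fin n → Bool
    memSym : ∀ u v → T (mem u v) → T (mem v u)
    sub    : ∀ u v → T (mem u v) → T (adj G u v)
open EdgeSubset public

InSub : ∀ {n} {G : SimpleGraph n} → EdgeSubset G → Edge n → Set
InSub M (u , v) = T (mem M u v)

IsMatching : ∀ {n} {G : SimpleGraph n} → EdgeSubset G → Set
IsMatching M = ∀ e f → InSub M e → InSub M f → ¬ AdjacentEdges e f

IsStrongSet : ∀ {n} (G : SimpleGraph n) → (Edge n → Set) → Set
IsStrongSet {n} G S =
  (∀ e f → S e → S f → ¬ AdjacentEdges e f) ×
  (∀ e f → S e → S f → ¬ SameEdge e f →
     ¬ (∃[ g ] (IsEdge G g × AdjacentEdges g e × AdjacentEdges g f)))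

-- ρ_G(M) ≤ q : M can be partitioned into q pairwise disjoint strong matchings
-- (a labelling of the edges of M by Fin q, well defined on unordered edges,
-- whose classes are strong matchings; empty classes are allowed, which does
-- not affect the value of the minimum q).
StrongPartition : ∀ {n} (G : SimpleGraph n) → EdgeSubset G → ℕ → Set
StrongPartition {n} G M q =
  Σ (Edge n → Fin q) λ lab →
    (∀ e f → InSub M e → SameEdge e f → lab e ≡ lab f) ×
    (∀ (i : Fin q) → IsStrongSet G (λ e → InSub M e × lab e ≡ i))

-- The contracted graph G_M.  Its vertices are the classes of Fin n under
-- the relation "equal, or the two ends of an edge of M" (an equivalence
-- relation when M is a matching).  Two classes are adjacent in G_M iff they
-- are distinct and some edge of G joins a member of one to a member of the
-- other (loops from contracted edges are deleted; multiplicities are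
-- irrelevant for colouring).
SameClass : ∀ {n} {G : SimpleGraph n} → EdgeSubset G → Fin n → Fin n → Set
SameClass M u v = u ≡ v ⊎ T (mem M u v)

ContrAdj : ∀ {n} {G : SimpleGraph n} → EdgeSubset G → Fin n → Fin n → Set
ContrAdj {G = G} M x y =
  ¬ SameClass M x y ×
  ∃[ u ] ∃[ v ] (SameClass M x u × SameClass M y v × T (adj G u v))

-- χ(G_M) ≤ k : a proper colouring of G_M with k colours, i.e. a colouring of
-- the vertex classes (a colouring of Fin n constant on classes) giving
-- adjacent classes different colours.
ContrColouring : ∀ {n} {G : SimpleGraph n} → EdgeSubset G → ℕ → Set
ContrColouring {n} M k =
  Σ (Fin n → Fin k) λ c →
    (∀ u v → SameClass M u v → c u ≡ c v) ×
    (∀ x y → ContrAdj M x y → c x ≢ c y)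

{-# OPTIONS --safe #-}
module Submission where

-- Colour each edge of M by the colour of its contracted vertex in a proper
-- colouring of G_M.  Two distinct edges of M in one colour class are disjoint,
-- and no edge of G can join them: such an edge would join two distinct
-- vertices of G_M of the same colour.  So the classes are strong matchings.

open import Defs
open import Data.Nat using (ℕ)
open import Data.Fin using (Fin)
open import Data.Bool using (T)
open import Data.Product using (_×_; _,_; proj₁; ∃-syntax)
open import Data.Sum using (_⊎_; inj₁; inj₂)
open import Data.Empty using (⊥)
open import Relation.Nullary using (¬_)
open import Relation.Binary.PropositionalEquality using (_≡_; _≢_; refl; trans) renaming (sym to ≡-sym)

module _ {n : ℕ} where

  SameEdge⇒Incident₂ : ∀ {p q : Fin n} (e : Edge n) → SameEdge (p , q) e → Incident q e
  SameEdge⇒Incident₂ _ (inj₁ (_ , q≡b)) = inj₂ q≡b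
  SameEdge⇒Incident₂ _ (inj₂ (_ , q≡a)) = inj₁ q≡a

  ends-equal-or-adjacent : ∀ (G : SimpleGraph n) {p q : Fin n} (g : Edge n) → IsEdge G g →
                           Incident p g → Incident q g → p ≡ q ⊎ T (adj G p q)
  ends-equal-or-adjacent G _       _  (inj₁ refl) (inj₁ refl) = inj₁ refl
  ends-equal-or-adjacent G _       _  (inj₂ refl) (inj₂ refl) = inj₁ refl
  ends-equal-or-adjacent G _       uv (inj₁ refl) (inj₂ refl) = inj₂ uv
  ends-equal-or-adjacent G (u , v) uv (inj₂ refl) (inj₁ refl) = inj₂ (SimpleGraph.sym G u v uv)

module _ {n : ℕ} {G : SimpleGraph n} (M : EdgeSubset G) (matching : IsMatching M)
         {e f : Edge n} (e∈M : InSub M e) (f∈M : InSub M f) (e≉f : ¬ SameEdge e f) where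

  matching-edges-disjoint : ∀ {p} → Incident p e → Incident p f → ⊥
  matching-edges-disjoint {p} p∈e p∈f = matching e f e∈M f∈M (e≉f , p , p∈e , p∈f)

  matching-edges-separate-classes : ∀ {p q} → Incident p e → Incident q f → ¬ SameClass M p q
  matching-edges-separate-classes p∈e q∈f (inj₁ refl) = matching-edges-disjoint p∈e q∈f
  matching-edges-separate-classes {p} {q} p∈e q∈f (inj₂ pq∈M) =
    matching (p , q) e pq∈M e∈M
      ((λ pq≈e → matching-edges-disjoint (SameEdge⇒Incident₂ e pq≈e) q∈f) , p , inj₁ refl , p∈e)

edgeColour : ∀ {n k : ℕ} → (Fin n → Fin k) → Edge n → Fin k
edgeColour c (a , _) = c a

module _ {n k : ℕ} {G : SimpleGraph n} (M : EdgeSubset G) (c : Fin n → Fin k)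
         (constant : ∀ u v → SameClass M u v → c u ≡ c v) where

  edgeColour-SameEdge : ∀ e f → InSub M e → SameEdge e f → edgeColour c e ≡ edgeColour c f
  edgeColour-SameEdge _       _ _  (inj₁ (refl , refl)) = refl
  edgeColour-SameEdge (a , b) _ ab (inj₂ (refl , refl)) = constant a b (inj₂ ab)

  edgeColour-Incident : ∀ {p} e → InSub M e → Incident p e → c p ≡ edgeColour c e
  edgeColour-Incident _       _  (inj₁ refl) = refl
  edgeColour-Incident (a , b) ab (inj₂ refl) = ≡-sym (constant a b (inj₂ ab))

  module _ (proper : ∀ x y → ContrAdj M x y → c x ≢ c y) (matching : IsMatching M)
           {e f : Edge n} (e∈M : InSub M e) (f∈M : InSub M f) (e≉f : ¬ SameEdge e f) where

    joined-matching-edges-coloured-apart : ∀ {p q} → Incident p e → Incident q f →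
                                           T (adj G p q) → edgeColour c e ≢ edgeColour c f
    joined-matching-edges-coloured-apart {p} {q} p∈e q∈f pq ce≡cf =
      proper p q (separate , p , q , inj₁ refl , inj₁ refl , pq)
        (trans (edgeColour-Incident e e∈M p∈e) (trans ce≡cf (≡-sym (edgeColour-Incident f f∈M q∈f))))
      where
      separate : ¬ SameClass M p q
      separate = matching-edges-separate-classes M matching e∈M f∈M e≉f p∈e q∈f

    colour-class-induced : edgeColour c e ≡ edgeColour c f →
                           ¬ (∃[ g ] (IsEdge G g × AdjacentEdges g e × AdjacentEdges g f))
    colour-class-induced ce≡cf (g , g∈G , (_ , p , p∈g , p∈e) , (_ , q , q∈g , q∈f))
      with ends-equal-or-adjacent G g g∈G p∈g q∈g
    ... | inj₁ refl = matching-edges-disjoint M matching e∈M f∈M e≉f p∈e q∈f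
    ... | inj₂ pq   = joined-matching-edges-coloured-apart p∈e q∈f pq ce≡cf

lemma2 : ∀ {n : ℕ} (G : SimpleGraph n) (M : EdgeSubset G) → IsMatching M →
           ∀ (k : ℕ) → ContrColouring M k → StrongPartition G M k
lemma2 G M matching k (c , constant , proper) =
  edgeColour c , edgeColour-SameEdge M c constant , λ i →
    (λ e f e∈class f∈class → matching e f (proj₁ e∈class) (proj₁ f∈class)) ,
    λ { e f (e∈M , ce≡i) (f∈M , cf≡i) e≉f →
          colour-class-induced M c constant proper matching e∈M f∈M e≉f (trans ce≡i (≡-sym cf≡i)) }
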